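{- Let $(X,\le)$ be a poset and $E$ an equivalence relation on $X$ with ${\le}\subseteq E$. Let $\alpha\colon X\to X$ be an order automorphism of $(X,\le)$ and $\beta\colon X\to X$ a self-inverse dual order automorphism of $(X,\le)$ such that $\alpha\subseteq E$, $\beta\subseteq E$ and $\beta=\alpha\circ\beta\circ\alpha$. Set $1={\le}$ and $0=\alpha\circ(\le^{c})^{\smile}$, and for $R\in\mathsf{Up}(\mathbf E)$ define ${\sim}R=R\backslash 0=(R^{\smile}\circ 0^{c})^{c}$, ${ - }R=0/R=(0^{c}\circ R^{\smile})^{c}$ and $R'=\alpha\circ\beta\circ R^{c}\circ\beta$. Then $$\mathbf{Dq}(\mathbf E)=\langle \mathsf{Up}(\mathbf E),\cap,\cup,\circ,1,0,{\sim},{ - },'\rangle$$ is a distributive quasi relation algebra. If $\alpha$ is the identity map, then $\mathbf{Dq}(\mathbf E)$ is a cyclic distributive quasi relation algebra.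
   Context: Binary relations on $X$: $R\circ S=\{(x,y)\mid \exists z\,((x,z)\in R,(z,y)\in S)\}$, $R^{\smile}=\{(x,y)\mid (y,x)\in R\}$. A function $\gamma\colon X\to X$ is identified with its graph $\{(x,\gamma(x))\mid x\in X\}$, so compositions such as $\alpha\circ R$ are relational compositions. An order automorphism is a bijection $\alpha$ with $x\le y\iff \alpha(x)\le\alpha(y)$; a dual order automorphism is a bijection $\beta$ with $x\le y\iff\beta(y)\le\beta(x)$; self-inverse means $\beta\circ\beta=\mathrm{id}_X$. The set $E$ is partially ordered by $(u,v)\preceq(x,y)$ iff $x\le u$ and $v\le y$; $\mathbf E=(E,\preceq)$ and $\mathsf{Up}(\mathbf E)$ is the set of its up-sets. For $R\subseteq E$, $R^{c}=E\setminus R$ (complement relative to $E$). A residuated lattice is $\langle A,\wedge,\vee,\cdot,1,\backslash,/\rangle$ with a lattice reduct, a monoid reduct $\langle A,\cdot,1\rangle$, and $a\cdot b\le c\iff a\le c/b\iff b\le a\backslash c$; an FL-algebra additionally has an arbitrary constant $0$, and one sets ${\sim}a=a\backslash 0$, ${ - }a=0/a$. It is involutive (InFL) if ${\sim}{ - }a={ - }{\sim}a=a$ for all $a$; then $a+b:={\sim}({ - }b\cdot{ - }a)$. A quasi relation algebra (qRA) $\langle A,\wedge,\vee,\cdot,1,0,{\sim},{ - },'\rangle$ is an InFL-algebra with a unary operation $'$ satisfying $a''=a$, $(a\vee b)'=a'\wedge b'$ (Dm), $({\sim}a)'={ - }(a')$ (Di) and $(a\cdot b)'=a'+b'$ (Dp).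 It is distributive (a DqRA) if its lattice reduct is distributive, and cyclic if ${\sim}a={ - }a$ for all $a$. -}

module Defs where

open import Level using (Level; _⊔_; suc)
open import Data.Product using (Σ; ∃; _×_; _,_)
open import Data.Sum using (_⊎_)
open import Relation.Nullary using (¬_)
open import Relation.Binary.Core using (Rel)
open import Relation.Binary.Structures using (IsEquivalence)
open import Relation.Binary.PropositionalEquality using (_≡_)
open import Relation.Unary using (Pred)
open import Algebra.Core using (Op₁; Op₂)
open import Function.Definitions using (Bijective)

module _ {ℓ : Level} {X : Set ℓ} where

  _⨾_ : Rel X ℓ → Rel X ℓ → Rel X ℓ
  (R ⨾ S) x y = ∃ λ z → R x z × S z y

  _˘ : Rel X ℓ → Rel X ℓ
  (R ˘) x y = R y x

  graph : (X → X) → Rel X ℓ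
  graph f x y = f x ≡ y

  _∩_ : Rel X ℓ → Rel X ℓ → Rel X ℓ
  (R ∩ S) x y = R x y × S x y

  _∪_ : Rel X ℓ → Rel X ℓ → Rel X ℓ
  (R ∪ S) x y = R x y ⊎ S x y

  _⊆ᵣ_ : Rel X ℓ → Rel X ℓ → Set ℓ
  R ⊆ᵣ S = ∀ {x y} → R x y → S x y

  _≐_ : Rel X ℓ → Rel X ℓ → Set ℓ
  R ≐ S = (R ⊆ᵣ S) × (S ⊆ᵣ R)

  IsOrderAutomorphism : Rel X ℓ → (X → X) → Set ℓ
  IsOrderAutomorphism _≤_ α =
    Bijective _≡_ _≡_ α × (∀ x y → (x ≤ y → α x ≤ α y) × (α x ≤ α y → x ≤ y))

  IsSelfInverseDualOrderAutomorphism : Rel X ℓ → (X → X) → Set ℓ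
  IsSelfInverseDualOrderAutomorphism _≤_ β =
    Bijective _≡_ _≡_ β
    × (∀ x y → (x ≤ y → β y ≤ β x) × (β y ≤ β x → x ≤ y))
    × (∀ x → β (β x) ≡ x)

module Dq {ℓ : Level} {X : Set ℓ} (_≤_ E : Rel X ℓ) (α β : X → X) where

  _ᶜ : Rel X ℓ → Rel X ℓ
  (R ᶜ) x y = E x y × ¬ R x y

  -- R ∈ Up(E): R ⊆ E and R is an up-set of (E, ≼), where
  -- (u,v) ≼ (x,y) iff x ≤ u and v ≤ y
  IsUp : Pred (Rel X ℓ) ℓ
  IsUp R = (R ⊆ᵣ E) × (∀ {u v x y} → E u v → E x y → x ≤ u → v ≤ y → R u v → R x y)

  1R : Rel X ℓ
  1R = _≤_

  0R : Rel X ℓ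
  0R = graph α ⨾ ((_≤_ ᶜ) ˘)

  _╲_ : Rel X ℓ → Rel X ℓ → Rel X ℓ
  R ╲ S = ((R ˘) ⨾ (S ᶜ)) ᶜ

  _╱_ : Rel X ℓ → Rel X ℓ → Rel X ℓ
  S ╱ R = ((S ᶜ) ⨾ (R ˘)) ᶜ

  ∼R : Rel X ℓ → Rel X ℓ
  ∼R R = R ╲ 0R

  -R : Rel X ℓ → Rel X ℓ
  -R R = 0R ╱ R

  _′ : Rel X ℓ → Rel X ℓ
  R ′ = ((graph α ⨾ graph β) ⨾ (R ᶜ)) ⨾ graph β

-- Distributive quasi relation algebras, presented on a subset `In` of a
-- carrier A (the universe of the algebra) with a setoid equality ≈.
-- The residuals \ and / are included as operations.

module _ {a p e : Level} {A : Set a} (In : Pred A p) (_≈_ : Rel A e)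
         (_∧_ _∨_ _·_ _\\_ _//_ : Op₂ A) (1# 0# : A) (∼ − _′′ : Op₁ A) where

  _≤ₗ_ : A → A → Set e
  x ≤ₗ y = (x ∧ y) ≈ x

  _⊕_ : A → A → A
  x ⊕ y = ∼ ((− y) · (− x))

  record IsDqRA : Set (a ⊔ p ⊔ e) where
    field
      ≈-equiv  : IsEquivalence _≈_
      ∧-cong   : ∀ {x y u v} → In x → In y → In u → In v → x ≈ y → u ≈ v → (x ∧ u) ≈ (y ∧ v)
      ∨-cong   : ∀ {x y u v} → In x → In y → In u → In v → x ≈ y → u ≈ v → (x ∨ u) ≈ (y ∨ v)
      ·-cong   : ∀ {x y u v} → In x → In y → In u → In v → x ≈ y → u ≈ v → (x · u) ≈ (y · v)
      \\-cong  : ∀ {x y u v} → In x → In y → In u → In v → x ≈ y → u ≈ v → (x \\ u) ≈ (y \\ v)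
      //-cong  : ∀ {x y u v} → In x → In y → In u → In v → x ≈ y → u ≈ v → (x // u) ≈ (y // v)
      ∼-cong   : ∀ {x y} → In x → In y → x ≈ y → ∼ x ≈ ∼ y
      −-cong   : ∀ {x y} → In x → In y → x ≈ y → − x ≈ − y
      ′-cong   : ∀ {x y} → In x → In y → x ≈ y → (x ′′) ≈ (y ′′)
      ∧-closed  : ∀ {x y} → In x → In y → In (x ∧ y)
      ∨-closed  : ∀ {x y} → In x → In y → In (x ∨ y)
      ·-closed  : ∀ {x y} → In x → In y → In (x · y)
      \\-closed : ∀ {x y} → In x → In y → In (x \\ y)
      //-closed : ∀ {x y} → In x → In y → In (x // y)
      1-closed  : In 1#
      0-closed  : In 0#
      ∼-closed  : ∀ {x} → In x → In (∼ x)
      −-closed  : ∀ {x} → In x → In (− x)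
      ′-closed  : ∀ {x} → In x → In (x ′′)
      ∧-assoc  : ∀ {x y z} → In x → In y → In z → ((x ∧ y) ∧ z) ≈ (x ∧ (y ∧ z))
      ∨-assoc  : ∀ {x y z} → In x → In y → In z → ((x ∨ y) ∨ z) ≈ (x ∨ (y ∨ z))
      ∧-comm   : ∀ {x y} → In x → In y → (x ∧ y) ≈ (y ∧ x)
      ∨-comm   : ∀ {x y} → In x → In y → (x ∨ y) ≈ (y ∨ x)
      ∧-absorbs-∨ : ∀ {x y} → In x → In y → (x ∧ (x ∨ y)) ≈ x
      ∨-absorbs-∧ : ∀ {x y} → In x → In y → (x ∨ (x ∧ y)) ≈ x
      distrib  : ∀ {x y z} → In x → In y → In z → (x ∧ (y ∨ z)) ≈ ((x ∧ y) ∨ (x ∧ z))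
      ·-assoc  : ∀ {x y z} → In x → In y → In z → ((x · y) · z) ≈ (x · (y · z))
      ·-identityˡ : ∀ {x} → In x → (1# · x) ≈ x
      ·-identityʳ : ∀ {x} → In x → (x · 1#) ≈ x
      resid-/₁ : ∀ {x y z} → In x → In y → In z → (x · y) ≤ₗ z → x ≤ₗ (z // y)
      resid-/₂ : ∀ {x y z} → In x → In y → In z → x ≤ₗ (z // y) → (x · y) ≤ₗ z
      resid-\₁ : ∀ {x y z} → In x → In y → In z → (x · y) ≤ₗ z → y ≤ₗ (x \\ z)
      resid-\₂ : ∀ {x y z} → In x → In y → In z → y ≤ₗ (x \\ z) → (x · y) ≤ₗ z
      ∼-def    : ∀ {x} → In x → ∼ x ≈ (x \\ 0#)
      −-def    : ∀ {x} → In x → − x ≈ (0# // x)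
      ∼−-inv   : ∀ {x} → In x → ∼ (− x) ≈ x
      −∼-inv   : ∀ {x} → In x → − (∼ x) ≈ x
      ′′-inv   : ∀ {x} → In x → ((x ′′) ′′) ≈ x
      Dm       : ∀ {x y} → In x → In y → ((x ∨ y) ′′) ≈ ((x ′′) ∧ (y ′′))
      Di       : ∀ {x} → In x → ((∼ x) ′′) ≈ − (x ′′)
      Dp       : ∀ {x y} → In x → In y → ((x · y) ′′) ≈ ((x ′′) ⊕ (y ′′))

  IsCyclic : Set (a ⊔ p ⊔ e)
  IsCyclic = ∀ {x} → In x → ∼ x ≈ − x

{-# OPTIONS --safe #-}
module Submission where

-- Up to excluded middle, each negation and the involution of Dq(E) is
-- "complement, then move the pair": inside E,
--   ∼R x y ⇔ (α⁻¹ y , x) ∉ R,   -R x y ⇔ (y , α x) ∉ R,   R′ x y ⇔ (βα x , β y) ∉ R.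
-- The double-negation laws then reduce to α⁻¹ ∘ α = id and (βα)² = id, the
-- latter being β = αβα together with β² = id.  Dm is De Morgan for complements,
-- and Di and Dp follow by moving pairs once more through
-- -(R′) x y ⇔ R (βα y) (βα x).  If α = id, both negations read (y , x) ∉ R.

open import Defs
open import Level using (Level)
open import Data.Product using (_×_; _,_; proj₁; proj₂)
open import Data.Sum using (inj₁; inj₂)
open import Function using (id)
open import Relation.Nullary using (¬_)
open import Relation.Binary.Core using (Rel)
open import Relation.Binary.Structures using (IsEquivalence; IsPreorder; IsPartialOrder)
open import Relation.Binary.PropositionalEquality
  using (_≡_; refl; sym; trans; cong; subst; subst₂)
open import Axiom.ExcludedMiddle using (ExcludedMiddle)
open import Axiom.DoubleNegationElimination using (DoubleNegationElimination; em⇒dne)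

module Relations {ℓ : Level} {X : Set ℓ} where

  private
    variable
      R R′ S S′ T : Rel X ℓ

  ≐-refl : R ≐ R
  ≐-refl = id , id

  ≐-isEquivalence : IsEquivalence (_≐_ {X = X})
  ≐-isEquivalence = record
    { refl  = ≐-refl
    ; sym   = λ (f , g) → g , f
    ; trans = λ (f , g) (h , k) → (λ r → h (f r)) , (λ r → g (k r))
    }

  ⊆⇒∩≐ : R ⊆ᵣ S → (R ∩ S) ≐ R
  ⊆⇒∩≐ f = proj₁ , λ r → r , f r

  ∩≐⇒⊆ : (R ∩ S) ≐ R → R ⊆ᵣ S
  ∩≐⇒⊆ (_ , g) r = proj₂ (g r)

  ∩-cong : R ≐ R′ → S ≐ S′ → (R ∩ S) ≐ (R′ ∩ S′)
  ∩-cong (f , g) (h , k) = (λ (r , s) → f r , h s) , (λ (r , s) → g r , k s)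

  ∪-cong : R ≐ R′ → S ≐ S′ → (R ∪ S) ≐ (R′ ∪ S′)
  ∪-cong (f , g) (h , k) =
    (λ { (inj₁ r) → inj₁ (f r) ; (inj₂ s) → inj₂ (h s) }) ,
    (λ { (inj₁ r) → inj₁ (g r) ; (inj₂ s) → inj₂ (k s) })

  ⨾-cong : R ≐ R′ → S ≐ S′ → (R ⨾ S) ≐ (R′ ⨾ S′)
  ⨾-cong (f , g) (h , k) = (λ (z , r , s) → z , f r , h s) , (λ (z , r , s) → z , g r , k s)

  ∩-assoc : ((R ∩ S) ∩ T) ≐ (R ∩ (S ∩ T))
  ∩-assoc = (λ ((r , s) , t) → r , s , t) , (λ (r , s , t) → (r , s) , t)

  ∪-assoc : ((R ∪ S) ∪ T) ≐ (R ∪ (S ∪ T))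
  ∪-assoc =
    (λ { (inj₁ (inj₁ r)) → inj₁ r ; (inj₁ (inj₂ s)) → inj₂ (inj₁ s) ; (inj₂ t) → inj₂ (inj₂ t) }) ,
    (λ { (inj₁ r) → inj₁ (inj₁ r) ; (inj₂ (inj₁ s)) → inj₁ (inj₂ s) ; (inj₂ (inj₂ t)) → inj₂ t })

  ∩-comm : (R ∩ S) ≐ (S ∩ R)
  ∩-comm = (λ (r , s) → s , r) , (λ (s , r) → r , s)

  ∪-comm : (R ∪ S) ≐ (S ∪ R)
  ∪-comm = (λ { (inj₁ r) → inj₂ r ; (inj₂ s) → inj₁ s }) ,
           (λ { (inj₁ s) → inj₂ s ; (inj₂ r) → inj₁ r })

  ∩-absorbs-∪ : (R ∩ (R ∪ S)) ≐ R
  ∩-absorbs-∪ = proj₁ , λ r → r , inj₁ r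

  ∪-absorbs-∩ : (R ∪ (R ∩ S)) ≐ R
  ∪-absorbs-∩ = (λ { (inj₁ r) → r ; (inj₂ (r , _)) → r }) , inj₁

  ∩-distribˡ-∪ : (R ∩ (S ∪ T)) ≐ ((R ∩ S) ∪ (R ∩ T))
  ∩-distribˡ-∪ =
    (λ { (r , inj₁ s) → inj₁ (r , s) ; (r , inj₂ t) → inj₂ (r , t) }) ,
    (λ { (inj₁ (r , s)) → r , inj₁ s ; (inj₂ (r , t)) → r , inj₂ t })

  ⨾-assoc : ((R ⨾ S) ⨾ T) ≐ (R ⨾ (S ⨾ T))
  ⨾-assoc = (λ (w , (z , r , s) , t) → z , r , w , s , t) ,
            (λ (z , r , w , s , t) → w , (z , r , s) , t)

module UpSets {ℓ : Level} {X : Set ℓ} (_≤_ E : Rel X ℓ) (α β : X → X)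
    (dne : DoubleNegationElimination ℓ)
    (≤-isPreorder : IsPreorder _≡_ _≤_)
    (E-isEquivalence : IsEquivalence E)
    (≤⊆E : _≤_ ⊆ᵣ E) where

  -- α and β only parametrise the 0, negations and involution of Dq; nothing
  -- outside the nested modules depends on them.
  open Dq _≤_ E α β
  open Relations
  open IsPreorder ≤-isPreorder using () renaming (refl to ≤-refl; trans to ≤-trans)
  open IsEquivalence E-isEquivalence using () renaming (sym to E-sym; trans to E-trans)

  private
    variable
      R R′ S S′ T : Rel X ℓ

  upward : IsUp R → ∀ {u v x y} → R u v → x ≤ u → v ≤ y → R x y
  upward (R⊆E , up) r x≤u v≤y =
    up (R⊆E r) (E-trans (≤⊆E x≤u) (E-trans (R⊆E r) (≤⊆E v≤y))) x≤u v≤y r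

  ∩-up : IsUp R → IsUp S → IsUp (R ∩ S)
  ∩-up upR upS = (λ (r , _) → proj₁ upR r) ,
    λ _ _ x≤u v≤y (r , s) → upward upR r x≤u v≤y , upward upS s x≤u v≤y

  ∪-up : IsUp R → IsUp S → IsUp (R ∪ S)
  ∪-up upR upS =
    (λ { (inj₁ r) → proj₁ upR r ; (inj₂ s) → proj₁ upS s }) ,
    λ { _ _ x≤u v≤y (inj₁ r) → inj₁ (upward upR r x≤u v≤y)
      ; _ _ x≤u v≤y (inj₂ s) → inj₂ (upward upS s x≤u v≤y) }

  ⨾-up : IsUp R → IsUp S → IsUp (R ⨾ S)
  ⨾-up upR upS = (λ (_ , r , s) → E-trans (proj₁ upR r) (proj₁ upS s)) ,
    λ _ _ x≤u v≤y (z , r , s) → z , upward upR r x≤u ≤-refl , upward upS s ≤-refl v≤y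

  ╲-up : IsUp R → IsUp T → IsUp (R ╲ T)
  ╲-up upR upT = proj₁ , λ Euv Exy x≤u v≤y (_ , n) → Exy , λ (z , r , Ezy , ¬t) →
    n (z , upward upR r ≤-refl x≤u ,
       E-trans (proj₁ upR r) (E-trans (≤⊆E x≤u) Euv) , λ t → ¬t (upward upT t ≤-refl v≤y))

  ╱-up : IsUp T → IsUp R → IsUp (T ╱ R)
  ╱-up upT upR = proj₁ , λ _ Exy x≤u v≤y (_ , n) → Exy , λ (z , (Exz , ¬t) , r) →
    n (z , (E-trans (E-sym (≤⊆E x≤u)) Exz , λ t → ¬t (upward upT t x≤u ≤-refl)) ,
       upward upR r v≤y ≤-refl)

  1R-up : IsUp 1R
  1R-up = ≤⊆E , λ _ _ x≤u v≤y u≤v → ≤-trans x≤u (≤-trans u≤v v≤y)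

  ⨾-identityˡ : IsUp R → (1R ⨾ R) ≐ R
  ⨾-identityˡ upR = (λ (_ , x≤z , r) → upward upR r x≤z ≤-refl) , (λ r → _ , ≤-refl , r)

  ⨾-identityʳ : IsUp R → (R ⨾ 1R) ≐ R
  ⨾-identityʳ upR = (λ (_ , r , z≤y) → upward upR r ≤-refl z≤y) , (λ r → _ , r , ≤-refl)

  ╲-mono : ∀ {R R′ S S′} → R′ ⊆ᵣ R → S ⊆ᵣ S′ → (R ╲ S) ⊆ᵣ (R′ ╲ S′)
  ╲-mono f g (e , n) = e , λ (z , r , Ezy , ¬s) → n (z , f r , Ezy , λ s → ¬s (g s))

  ╱-mono : ∀ {R R′ S S′} → R′ ⊆ᵣ R → S ⊆ᵣ S′ → (S ╱ R) ⊆ᵣ (S′ ╱ R′)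
  ╱-mono f g (e , n) = e , λ (z , (Exz , ¬s) , r) → n (z , (Exz , λ s → ¬s (g s)) , f r)

  ╲-cong : ∀ {R R′ S S′} → R ≐ R′ → S ≐ S′ → (R ╲ S) ≐ (R′ ╲ S′)
  ╲-cong {R} {R′} {S} {S′} (f , g) (h , k) =
    ╲-mono {R} {R′} {S} {S′} g h , ╲-mono {R′} {R} {S′} {S} f k

  ╱-cong : ∀ {R R′ S S′} → S ≐ S′ → R ≐ R′ → (S ╱ R) ≐ (S′ ╱ R′)
  ╱-cong {R} {R′} {S} {S′} (f , g) (h , k) =
    ╱-mono {R} {R′} {S} {S′} k f , ╱-mono {R′} {R} {S′} {S} h g

  ⨾⊆⇒⊆╱ : IsUp R → (R ⨾ S) ⊆ᵣ T → R ⊆ᵣ (T ╱ S)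
  ⨾⊆⇒⊆╱ upR f r = proj₁ upR r , λ (_ , (_ , ¬t) , s) → ¬t (f (_ , r , s))

  ⊆╱⇒⨾⊆ : IsUp R → IsUp S → R ⊆ᵣ (T ╱ S) → (R ⨾ S) ⊆ᵣ T
  ⊆╱⇒⨾⊆ upR upS f (_ , r , s) =
    dne λ ¬t → proj₂ (f r) (_ , (E-trans (proj₁ upR r) (proj₁ upS s) , ¬t) , s)

  ⨾⊆⇒⊆╲ : IsUp S → (R ⨾ S) ⊆ᵣ T → S ⊆ᵣ (R ╲ T)
  ⨾⊆⇒⊆╲ upS f s = proj₁ upS s , λ (_ , r , _ , ¬t) → ¬t (f (_ , r , s))

  ⊆╲⇒⨾⊆ : IsUp R → IsUp S → S ⊆ᵣ (R ╲ T) → (R ⨾ S) ⊆ᵣ T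
  ⊆╲⇒⨾⊆ upR upS f (_ , r , s) =
    dne λ ¬t → proj₂ (f s) (_ , r , E-trans (proj₁ upR r) (proj₁ upS s) , ¬t)

  module Negations (α-aut : IsOrderAutomorphism _≤_ α) (αE : graph α ⊆ᵣ E) where

    α-mono : ∀ {x y} → x ≤ y → α x ≤ α y
    α-mono {x} {y} = proj₁ (proj₂ α-aut x y)

    α-reflects : ∀ {x y} → α x ≤ α y → x ≤ y
    α-reflects {x} {y} = proj₂ (proj₂ α-aut x y)

    α⁻¹ : X → X
    α⁻¹ y = proj₁ (proj₂ (proj₁ α-aut) y)

    α∘α⁻¹ : ∀ y → α (α⁻¹ y) ≡ y
    α∘α⁻¹ y = proj₂ (proj₂ (proj₁ α-aut) y) refl

    α⁻¹∘α : ∀ x → α⁻¹ (α x) ≡ x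
    α⁻¹∘α x = proj₁ (proj₁ α-aut) (α∘α⁻¹ (α x))

    α⁻¹-mono : ∀ {x y} → x ≤ y → α⁻¹ x ≤ α⁻¹ y
    α⁻¹-mono x≤y = α-reflects (subst₂ _≤_ (sym (α∘α⁻¹ _)) (sym (α∘α⁻¹ _)) x≤y)

    E-α : ∀ x → E x (α x)
    E-α x = αE refl

    E-α⁻¹ : ∀ y → E (α⁻¹ y) y
    E-α⁻¹ y = subst (E (α⁻¹ y)) (α∘α⁻¹ y) (E-α (α⁻¹ y))

    0R⁺ : ∀ {x y} → E x y → ¬ y ≤ α x → 0R x y
    0R⁺ {x} Exy y≰αx = α x , refl , E-trans (E-sym Exy) (E-α x) , y≰αx

    0R⁻ : ∀ {x y} → 0R x y → ¬ y ≤ α x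
    0R⁻ (_ , refl , _ , y≰αx) = y≰αx

    ¬0R⇒≤α : ∀ {x y} → E x y → ¬ 0R x y → y ≤ α x
    ¬0R⇒≤α Exy ¬0 = dne λ y≰αx → ¬0 (0R⁺ Exy y≰αx)

    0R-up : IsUp 0R
    0R-up = (λ { (_ , refl , Eyz , _) → E-trans (E-α _) (E-sym Eyz) }) ,
      λ _ Exy x≤u v≤y 0uv → 0R⁺ Exy λ y≤αx → 0R⁻ 0uv (≤-trans v≤y (≤-trans y≤αx (α-mono x≤u)))

    ∼R⁻ : ∀ {x y} → ∼R R x y → ¬ R (α⁻¹ y) x
    ∼R⁻ {y = y} (_ , n) r =
      n (α⁻¹ y , r , E-α⁻¹ y , λ 0αy → 0R⁻ 0αy (subst (y ≤_) (sym (α∘α⁻¹ y)) ≤-refl))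

    ∼R⁺ : IsUp R → ∀ {x y} → E x y → ¬ R (α⁻¹ y) x → ∼R R x y
    ∼R⁺ upR {y = y} Exy n = Exy , λ (z , r , Ezy , ¬0) →
      n (upward upR r (subst (α⁻¹ y ≤_) (α⁻¹∘α z) (α⁻¹-mono (¬0R⇒≤α Ezy ¬0))) ≤-refl)

    -R⁻ : ∀ {x y} → -R R x y → ¬ R y (α x)
    -R⁻ {x = x} (_ , n) r = n (α x , (E-α x , λ 0xαx → 0R⁻ 0xαx ≤-refl) , r)

    -R⁺ : IsUp R → ∀ {x y} → E x y → ¬ R y (α x) → -R R x y
    -R⁺ upR Exy n = Exy , λ (z , (Exz , ¬0) , r) → n (upward upR r ≤-refl (¬0R⇒≤α Exz ¬0))

    ∼-R-involutive : IsUp R → ∼R (-R R) ≐ R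
    ∼-R-involutive {R} upR =
      (λ {x} {y} m → dne λ ¬r → ∼R⁻ {R = -R R} m
        (-R⁺ upR (E-trans (E-α⁻¹ y) (E-sym (proj₁ m))) λ r → ¬r (subst (R x) (α∘α⁻¹ y) r))) ,
      (λ {x} {y} r → ∼R⁺ (╱-up 0R-up upR) (proj₁ upR r) λ m →
        -R⁻ {R = R} m (subst (R x) (sym (α∘α⁻¹ y)) r))

    -∼R-involutive : IsUp R → -R (∼R R) ≐ R
    -∼R-involutive {R} upR =
      (λ {x} {y} m → dne λ ¬r → -R⁻ {R = ∼R R} m
        (∼R⁺ upR (E-trans (E-sym (proj₁ m)) (E-α x)) λ r → ¬r (subst (λ t → R t y) (α⁻¹∘α x) r))) ,
      (λ {x} {y} r → -R⁺ (╲-up upR 0R-up) (proj₁ upR r) λ m →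
        ∼R⁻ {R = R} m (subst (λ t → R t y) (sym (α⁻¹∘α x)) r))

    ∼R≐-R : (∀ x → α x ≡ x) → IsUp R → ∼R R ≐ -R R
    ∼R≐-R {R} α≗id upR =
      (λ {x} {y} m → -R⁺ upR (proj₁ m) λ r → ∼R⁻ {R = R} m (subst₂ R (sym (α⁻¹≗id y)) (α≗id x) r)) ,
      (λ {x} {y} m → ∼R⁺ upR (proj₁ m) λ r → -R⁻ {R = R} m (subst₂ R (α⁻¹≗id y) (sym (α≗id x)) r))
      where
      α⁻¹≗id : ∀ y → α⁻¹ y ≡ y
      α⁻¹≗id y = trans (cong α⁻¹ (sym (α≗id y))) (α⁻¹∘α y)

    module Involution (β-aut : IsSelfInverseDualOrderAutomorphism _≤_ β) (βE : graph β ⊆ᵣ E)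
        (β≐αβα : graph β ≐ ((graph α ⨾ graph β) ⨾ graph α)) where

      β-anti : ∀ {x y} → x ≤ y → β y ≤ β x
      β-anti {x} {y} = proj₁ (proj₁ (proj₂ β-aut) x y)

      β∘β : ∀ x → β (β x) ≡ x
      β∘β = proj₂ (proj₂ β-aut)

      α∘β∘α : ∀ x → α (β (α x)) ≡ β x
      α∘β∘α x with proj₁ β≐αβα {x} {β x} refl
      ... | _ , (_ , refl , refl) , αβαx≡βx = αβαx≡βx

      βα : X → X
      βα x = β (α x)

      βα-anti : ∀ {x y} → x ≤ y → βα y ≤ βα x
      βα-anti x≤y = β-anti (α-mono x≤y)

      βα-involutive : ∀ x → βα (βα x) ≡ x
      βα-involutive x = trans (cong β (α∘β∘α x)) (β∘β x)

      α⁻¹∘β : ∀ y → α⁻¹ (β y) ≡ βα y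
      α⁻¹∘β y = trans (cong α⁻¹ (sym (α∘β∘α y))) (α⁻¹∘α (βα y))

      E-β : ∀ x → E x (β x)
      E-β x = βE refl

      E-βα : ∀ x → E x (βα x)
      E-βα x = E-trans (E-α x) (E-β (α x))

      E-βα-β : ∀ {x y} → E x y → E (βα x) (β y)
      E-βα-β {x} {y} Exy = E-trans (E-sym (E-βα x)) (E-trans Exy (E-β y))

      ′⊆E : (R ′) ⊆ᵣ E
      ′⊆E {x = x} (w , (_ , (_ , refl , refl) , Eβαxw , _) , refl) =
        E-trans (E-βα x) (E-trans Eβαxw (E-β w))

      ′⁻ : ∀ {x y} → (R ′) x y → ¬ R (βα x) (β y)
      ′⁻ {R} (w , (_ , (_ , refl , refl) , _ , ¬r) , refl) = subst (λ t → ¬ R _ t) (sym (β∘β w)) ¬r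

      ′⁺ : ∀ {x y} → E x y → ¬ R (βα x) (β y) → (R ′) x y
      ′⁺ {x = x} {y} Exy ¬r = β y , (βα x , (α x , refl , refl) , E-βα-β Exy , ¬r) , β∘β y

      ′-up : IsUp R → IsUp (R ′)
      ′-up upR = ′⊆E , λ _ Exy x≤u v≤y m →
        ′⁺ Exy λ r → ′⁻ m (upward upR r (βα-anti x≤u) (β-anti v≤y))

      ′-mono : ∀ {R S} → S ⊆ᵣ R → (R ′) ⊆ᵣ (S ′)
      ′-mono f m = ′⁺ (′⊆E m) λ s → ′⁻ m (f s)

      ′-cong : ∀ {R S} → R ≐ S → (R ′) ≐ (S ′)
      ′-cong {R} {S} (f , g) = ′-mono {R} {S} g , ′-mono {S} {R} f

      ′-involutive : IsUp R → ((R ′) ′) ≐ R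
      ′-involutive {R} upR =
        (λ {x} {y} m → dne λ ¬r → ′⁻ m
          (′⁺ (E-βα-β (′⊆E m)) λ r → ¬r (subst₂ R (βα-involutive x) (β∘β y) r))) ,
        (λ {x} {y} r → ′⁺ (proj₁ upR r) λ m →
          ′⁻ m (subst₂ R (sym (βα-involutive x)) (sym (β∘β y)) r))

      ′-∪ : ((R ∪ S) ′) ≐ ((R ′) ∩ (S ′))
      ′-∪ =
        (λ m → ′⁺ (′⊆E m) (λ r → ′⁻ m (inj₁ r)) ,
               ′⁺ (′⊆E m) (λ s → ′⁻ m (inj₂ s))) ,
        (λ (mR , mS) → ′⁺ (′⊆E mR)
          λ { (inj₁ r) → ′⁻ mR r ; (inj₂ s) → ′⁻ mS s })

      -R′⁻ : ∀ {x y} → -R (R ′) x y → R (βα y) (βα x)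
      -R′⁻ {R} {x} m = dne λ ¬r → -R⁻ {R = R ′} m (′⁺ (E-trans (E-sym (proj₁ m)) (E-α x)) ¬r)

      -R′⁺ : IsUp R → ∀ {x y} → E x y → R (βα y) (βα x) → -R (R ′) x y
      -R′⁺ upR Exy r = -R⁺ (′-up upR) Exy λ r′ → ′⁻ r′ r

      ′-∼R : IsUp R → ((∼R R) ′) ≐ -R (R ′)
      ′-∼R {R} upR =
        (λ {x} {y} m → -R′⁺ upR (′⊆E m) (dne λ ¬r → ′⁻ m
          (∼R⁺ upR (E-βα-β (′⊆E m)) λ r → ¬r (subst (λ t → R t (βα x)) (α⁻¹∘β y) r)))) ,
        (λ {x} {y} m → ′⁺ (proj₁ m) λ s →
          ∼R⁻ {R = R} s (subst (λ t → R t (βα x)) (sym (α⁻¹∘β y)) (-R′⁻ m)))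

      ′-⨾⊆ : IsUp R → IsUp S → ((R ⨾ S) ′) ⊆ᵣ ∼R (-R (S ′) ⨾ -R (R ′))
      ′-⨾⊆ {S = S} upR upS {y = y} m =
        ∼R⁺ (⨾-up (╱-up 0R-up (′-up upS)) (╱-up 0R-up (′-up upR))) (′⊆E m)
          λ (z , a , b) → ′⁻ m
            (βα z , -R′⁻ b , subst (S (βα z)) (cong β (α∘α⁻¹ y)) (-R′⁻ a))

      ′-⨾⊇ : IsUp R → IsUp S → ∼R (-R (S ′) ⨾ -R (R ′)) ⊆ᵣ ((R ⨾ S) ′)
      ′-⨾⊇ {R} {S} upR upS {x} {y} m = ′⁺ (proj₁ m) λ (w , r , s) →
        let w′ = βα-involutive w
            Ew = E-βα w
            a = -R′⁺ upS (E-trans (E-α⁻¹ y) (E-trans (E-β y) (E-trans (E-sym (proj₁ upS s)) Ew)))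
                  (subst₂ S (sym w′) (sym (cong β (α∘α⁻¹ y))) s)
            b = -R′⁺ upR (E-trans (E-sym Ew) (E-trans (E-sym (proj₁ upR r)) (E-sym (E-βα x))))
                  (subst (R (βα x)) (sym w′) r)
        in ∼R⁻ {R = -R (S ′) ⨾ -R (R ′)} m (βα w , a , b)

      isDqRA : IsDqRA IsUp _≐_ _∩_ _∪_ _⨾_ _╲_ _╱_ 1R 0R ∼R -R _′
      isDqRA = record
        { ≈-equiv     = ≐-isEquivalence
        ; ∧-cong      = λ _ _ _ _ → ∩-cong
        ; ∨-cong      = λ _ _ _ _ → ∪-cong
        ; ·-cong      = λ _ _ _ _ → ⨾-cong
        ; \\-cong     = λ _ _ _ _ → ╲-cong
        ; //-cong     = λ _ _ _ _ → ╱-cong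
        ; ∼-cong      = λ _ _ R≐S → ╲-cong R≐S ≐-refl
        ; −-cong      = λ _ _ R≐S → ╱-cong ≐-refl R≐S
        ; ′-cong      = λ _ _ → ′-cong
        ; ∧-closed    = ∩-up
        ; ∨-closed    = ∪-up
        ; ·-closed    = ⨾-up
        ; \\-closed   = ╲-up
        ; //-closed   = ╱-up
        ; 1-closed    = 1R-up
        ; 0-closed    = 0R-up
        ; ∼-closed    = λ upR → ╲-up upR 0R-up
        ; −-closed    = ╱-up 0R-up
        ; ′-closed    = ′-up
        ; ∧-assoc     = λ _ _ _ → ∩-assoc
        ; ∨-assoc     = λ _ _ _ → ∪-assoc
        ; ∧-comm      = λ _ _ → ∩-comm
        ; ∨-comm      = λ _ _ → ∪-comm
        ; ∧-absorbs-∨ = λ _ _ → ∩-absorbs-∪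
        ; ∨-absorbs-∧ = λ _ _ → ∪-absorbs-∩
        ; distrib     = λ _ _ _ → ∩-distribˡ-∪
        ; ·-assoc     = λ _ _ _ → ⨾-assoc
        ; ·-identityˡ = ⨾-identityˡ
        ; ·-identityʳ = ⨾-identityʳ
        ; resid-/₁    = λ upR _ _ h → ⊆⇒∩≐ (⨾⊆⇒⊆╱ upR (∩≐⇒⊆ h))
        ; resid-/₂    = λ upR upS _ h → ⊆⇒∩≐ (⊆╱⇒⨾⊆ upR upS (∩≐⇒⊆ h))
        ; resid-\₁    = λ _ upS _ h → ⊆⇒∩≐ (⨾⊆⇒⊆╲ upS (∩≐⇒⊆ h))
        ; resid-\₂    = λ upR upS _ h → ⊆⇒∩≐ (⊆╲⇒⨾⊆ upR upS (∩≐⇒⊆ h))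
        ; ∼-def       = λ _ → ≐-refl
        ; −-def       = λ _ → ≐-refl
        ; ∼−-inv      = ∼-R-involutive
        ; −∼-inv      = -∼R-involutive
        ; ′′-inv      = ′-involutive
        ; Dm          = λ _ _ → ′-∪
        ; Di          = ′-∼R
        ; Dp          = λ upR upS → ′-⨾⊆ upR upS , ′-⨾⊇ upR upS
        }

theorem3p15 : ∀ {ℓ : Level} {X : Set ℓ} (_≤_ E : Rel X ℓ) (α β : X → X)
    → ExcludedMiddle ℓ
    → IsPartialOrder _≡_ _≤_
    → IsEquivalence E
    → _≤_ ⊆ᵣ E
    → IsOrderAutomorphism _≤_ α
    → IsSelfInverseDualOrderAutomorphism _≤_ β
    → graph α ⊆ᵣ E
    → graph β ⊆ᵣ E
    → graph β ≐ ((graph α ⨾ graph β) ⨾ graph α)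
    → IsDqRA (Dq.IsUp _≤_ E α β) _≐_ _∩_ _∪_ _⨾_ (Dq._╲_ _≤_ E α β) (Dq._╱_ _≤_ E α β)
        (Dq.1R _≤_ E α β) (Dq.0R _≤_ E α β) (Dq.∼R _≤_ E α β) (Dq.-R _≤_ E α β) (Dq._′ _≤_ E α β)
      × ((∀ x → α x ≡ x)
         → IsCyclic (Dq.IsUp _≤_ E α β) _≐_ _∩_ _∪_ _⨾_ (Dq._╲_ _≤_ E α β) (Dq._╱_ _≤_ E α β)
             (Dq.1R _≤_ E α β) (Dq.0R _≤_ E α β) (Dq.∼R _≤_ E α β) (Dq.-R _≤_ E α β) (Dq._′ _≤_ E α β))
theorem3p15 _≤_ E α β em ≤-isPartialOrder E-isEquivalence ≤⊆E α-aut β-aut αE βE β≐αβα =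
  isDqRA , λ α≗id → ∼R≐-R α≗id
  where
  open UpSets _≤_ E α β (em⇒dne em) (IsPartialOrder.isPreorder ≤-isPartialOrder) E-isEquivalence ≤⊆E
  open Negations α-aut αE
  open Involution β-aut βE β≐αβα
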